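{- Let $G=(V,E)$ be a finite, connected, undirected graph (multiple edges allowed, no loops), and let $D$ be a divisor with $\beta_{1,D}=\dim_{\mathbb{C}}\widetilde H_0(\Delta_D;\mathbb{C})>0$. Let $|D|=\mathcal{A}\sqcup\mathcal{B}$ be any splitting of $D$. Then there exist $D_A\in\mathcal{A}$ and $D_B\in\mathcal{B}$ such that, with $S_A=\operatorname{supp}(D_A)$ and $S_B=\operatorname{supp}(D_B)$, the set of edges between $S_A$ and $S_B$ is exactly the set of edges crossing some cut $\{A,B\}$ of $G$; moreover, the boundary divisors of this cut are equivalent to $D$.
   Context: The Laplacian $L$ has $L_{vv}=\deg(v)$ and $L_{uv}=-(\text{number of edges between }u,v)$ for $u\ne v$; divisors are elements of $\mathbb{Z}^V$, $D\sim D'$ iff $D-D'\in L(\mathbb{Z}^V)$; effective means all entries $\ge0$; $\operatorname{supp}(D)=\{v:D_v\neq0\}$; $|D|=\{D'\ge0: D'\sim D\}$; $\Delta_D$ is the simplicial complex of all $W\subseteq V$ with $W\subseteq\operatorname{supp}(D')$ for some $D'\in|D|$. A divisor $D_0\in|D|$ is a composing divisor of a connected component $C$ of $\Delta_D$ if $\operatorname{supp}(D_0)\subseteq C$. A splitting of $D$ is a partition of $|D|$ into two nonempty disjoint sets $\mathcal{A},\mathcal{B}$ such that for every connected component $C$ of $\Delta_D$, all composing divisors of $C$ lie in the same one of $\mathcal{A},\mathcal{B}$. A cut of $G$ is an unordered partition $\{A,B\}$ of $V$ into two nonempty sets each inducing a connected subgraph; its boundary divisors are the divisors $D'$ with $D'_v=\deg_{AB}(v)\chi_X(v)$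 for all $v$, for $X\in\{A,B\}$, where $\deg_{AB}(v)$ is the number of edges incident to $v$ with one endpoint in $A$ and the other in $B$. -}

module Defs where

open import Data.Nat as ℕ using (ℕ; zero; suc)
open import Data.Integer as ℤ using (ℤ; +_; 0ℤ)
open import Data.Fin using (Fin; zero; suc)
open import Data.Bool using (Bool; true; false; not; if_then_else_; _xor_)
open import Data.Empty using (⊥)
open import Data.Product using (Σ; ∃; _×_; _,_)
open import Data.Sum using (_⊎_)
open import Data.Unit using (⊤)
open import Relation.Nullary using (¬_)
open import Relation.Binary.PropositionalEquality using (_≡_; _≢_)

-- Finite multigraphs on the vertex set Fin n, no loops.
-- w u v = number of edges between u and v.

record Graph (n : ℕ) : Set where
  field
    w      : Fin n → Fin n → ℕ
    w-sym  : ∀ u v → w u v ≡ w v u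
    noLoop : ∀ v → w v v ≡ 0
open Graph public

ΣFin : ∀ {A : Set} → (A → A → A) → A → (n : ℕ) → (Fin n → A) → A
ΣFin _⊕_ e zero    f = e
ΣFin _⊕_ e (suc n) f = f zero ⊕ ΣFin _⊕_ e n (λ i → f (suc i))

sumℕ : (n : ℕ) → (Fin n → ℕ) → ℕ
sumℕ = ΣFin ℕ._+_ 0

sumℤ : (n : ℕ) → (Fin n → ℤ) → ℤ
sumℤ = ΣFin ℤ._+_ 0ℤ

module _ {n : ℕ} (G : Graph n) where

  deg : Fin n → ℕ
  deg v = sumℕ n (λ u → w G v u)

  data PathIn (X : Fin n → Set) : Fin n → Fin n → Set where
    here : ∀ {u} → X u → PathIn X u u
    step : ∀ {u v t} → X u → 0 ℕ.< w G u v → PathIn X v t → PathIn X u t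

  Connected : Set
  Connected = ∀ u v → PathIn (λ _ → ⊤) u v

  InducesConnected : (Fin n → Set) → Set
  InducesConnected X = ∀ u v → X u → X v → PathIn X u v

Divisor : ℕ → Set
Divisor n = Fin n → ℤ

module _ {n : ℕ} (G : Graph n) where

  laplacian : (Fin n → ℤ) → Divisor n
  laplacian f v = (+ deg G v) ℤ.* f v ℤ.- sumℤ n (λ u → (+ w G v u) ℤ.* f u)

  _∼_ : Divisor n → Divisor n → Set
  D ∼ D' = Σ (Fin n → ℤ) λ f → ∀ v → D v ℤ.- D' v ≡ laplacian f v

  Effective : Divisor n → Set
  Effective D = ∀ v → 0ℤ ℤ.≤ D v

  InSupp : Divisor n → Fin n → Set
  InSupp D v = D v ≢ 0ℤ

  InLinSys : Divisor n → Divisor n → Set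
  InLinSys D D' = Effective D' × (D' ∼ D)

  VertexΔ : Divisor n → Fin n → Set
  VertexΔ D v = Σ (Divisor n) λ D' → InLinSys D D' × InSupp D' v

  EdgeΔ : Divisor n → Fin n → Fin n → Set
  EdgeΔ D u v = Σ (Divisor n) λ D' → InLinSys D D' × InSupp D' u × InSupp D' v

  data ConnΔ (D : Divisor n) : Fin n → Fin n → Set where
    refl  : ∀ {u} → VertexΔ D u → ConnΔ D u u
    step  : ∀ {u v t} → EdgeΔ D u v → ConnΔ D v t → ConnΔ D u t

  Composing : Divisor n → Fin n → Divisor n → Set
  Composing D c D₀ = InLinSys D D₀ × (∀ v → InSupp D₀ v → ConnΔ D c v)

  -- β_{1,D} > 0, i.e. Δ_D has at least two connected components
  -- (dim reduced H₀(Δ;ℂ) = #components - 1 for a nonempty complex)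
  Disconnected : Divisor n → Set
  Disconnected D = Σ (Fin n) λ u → Σ (Fin n) λ v →
    VertexΔ D u × VertexΔ D v × ¬ ConnΔ D u v

  record Splitting (D : Divisor n) (𝒜 ℬ : Divisor n → Set) : Set where
    field
      𝒜⊆ : ∀ D' → 𝒜 D' → InLinSys D D'
      ℬ⊆ : ∀ D' → ℬ D' → InLinSys D D'
      cover : ∀ D' → InLinSys D D' → 𝒜 D' ⊎ ℬ D'
      disjoint : ∀ D' → 𝒜 D' → ℬ D' → ⊥
      𝒜-nonempty : Σ (Divisor n) 𝒜
      ℬ-nonempty : Σ (Divisor n) ℬ
      compatible : ∀ c → VertexΔ D c → ∀ D₁ D₂ →
        Composing D c D₁ → Composing D c D₂ →
        (𝒜 D₁ × 𝒜 D₂) ⊎ (ℬ D₁ × ℬ D₂)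

  InA InB : (Fin n → Bool) → Fin n → Set
  InA side v = side v ≡ true
  InB side v = side v ≡ false

  IsCut : (Fin n → Bool) → Set
  IsCut side = Σ (Fin n) (InA side) × Σ (Fin n) (InB side)
             × InducesConnected G (InA side) × InducesConnected G (InB side)

  degAB : (Fin n → Bool) → Fin n → ℕ
  degAB side v = sumℕ n (λ u → if side u xor side v then w G v u else 0)

  -- boundary divisor for the side 'b' (b = true: A, b = false: B)
  boundary : (Fin n → Bool) → Bool → Divisor n
  boundary side b v = if side v xor b then 0ℤ else + degAB side v

  Between : (Fin n → Set) → (Fin n → Set) → Fin n → Fin n → Set
  Between S T u v = (S u × T v) ⊎ (T u × S v)

-- Pick E ∈ 𝒜 and E′ ∈ ℬ, so E − E′ = Δf for some f.  Firing, one at a time, the level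
-- sets on which f is maximal leads from E to E′ through effective divisors, so some step
-- turns a divisor X ∈ 𝒜 into X − Δχ_S ∈ ℬ.  Divisors from different classes have disjoint
-- supports, while Δχ_S is the difference of the two boundary divisors of the bipartition
-- (S, V ∖ S), which are non-negative with disjoint supports; so X and X − Δχ_S are exactly
-- these boundary divisors.  Finally each side induces a connected subgraph: if the
-- component R of a vertex of S missed part of S, firing R from X would give a divisor of
-- |D| meeting the support of X − Δχ_S (across an edge leaving R) and that of X (across
-- an edge leaving S ∖ R), which could then lie in neither class.
module Submission where

open import Defs
open import Data.Bool using (Bool; true; false; not; _∧_; if_then_else_; _xor_)
import Data.Bool.Properties as BP
open import Data.Empty using (⊥; ⊥-elim)
open import Data.Fin using (Fin; zero; suc)
open import Data.Fin.Properties using (any?)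
open import Data.Fin.Subset using (Subset; _∈_; _∪_; ⁅_⁆; _⊃_)
open import Data.Fin.Subset.Induction using (⊃-wellFounded)
open import Data.Fin.Subset.Properties using (_∈?_; x∈⁅x⁆; x∈⁅y⁆⇒x≡y; p⊆p∪q; q⊆p∪q; x∈p∪q⁻)
open import Data.Integer as ℤ using (ℤ; +_; -[1+_]; 0ℤ; 1ℤ; -1ℤ; -_; ∣_∣; +≤+; _+_; _-_; _*_; _≤_)
import Data.Integer.Properties as ℤP
open import Algebra.Properties.Semiring.Sum ℤP.+-*-semiring
  using (sum; sum-syntax; sum-cong-≗; sum-replicate-zero; ∑-distrib-+; ∑-comm; *-distribˡ-sum; *-distribʳ-sum)
open import Data.Integer.Tactic.RingSolver using (solve-∀)
open import Data.Nat as ℕ using (ℕ; zero; suc; _<_)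
import Data.Nat.Properties as ℕP
open import Data.Product as Product using (Σ; ∃; _×_; _,_; proj₁; proj₂)
open import Data.Sum as Sum using (_⊎_; inj₁; inj₂)
open import Data.Vec.Functional using (foldr)
open import Function using (_∘_; id)
open import Function.Bundles using (_⇔_; mk⇔; Equivalence)
open import Induction.WellFounded using (Acc; acc)
open import Relation.Binary.PropositionalEquality
open import Relation.Nullary using (Dec; yes; no; does; proof; contradiction)
open import Relation.Nullary.Decidable using (dec-true; decidable-stable; ¬?; _×-dec_)
open import Relation.Nullary.Reflects using (Reflects; invert)

nonneg-+-zero : ∀ {i j} → 0ℤ ≤ i → 0ℤ ≤ j → i + j ≡ 0ℤ → i ≡ 0ℤ × j ≡ 0ℤ
nonneg-+-zero {+ m} {+ k} _ _ m+k≡0 =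
  cong +_ (ℕP.m+n≡0⇒m≡0 m (ℤP.+-injective m+k≡0)) , cong +_ (ℕP.m+n≡0⇒n≡0 m (ℤP.+-injective m+k≡0))

≢0-mono-≤ : ∀ {x z} → 0ℤ ≤ x → x ≤ z → x ≢ 0ℤ → z ≢ 0ℤ
≢0-mono-≤ {x} x≥0 x≤z x≢0 z≡0 = x≢0 (ℤP.≤-antisym (subst (x ≤_) z≡0 x≤z) x≥0)

difference-parts-unique : ∀ {x y p q} → 0ℤ ≤ x → 0ℤ ≤ y → 0ℤ ≤ p → 0ℤ ≤ q →
  x ≡ 0ℤ ⊎ y ≡ 0ℤ → p ≡ 0ℤ ⊎ q ≡ 0ℤ → x - y ≡ p - q → x ≡ p × y ≡ q
difference-parts-unique {x} {y} {p} {q} x≥0 y≥0 p≥0 q≥0 x∨y p∨q x-y≡p-q = parts x∨y p∨q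
  where
  balance : x + q ≡ p + y
  balance = begin
    x + q               ≡⟨ regroup x y q ⟩
    (x - y) + (y + q)   ≡⟨ cong (_+ (y + q)) x-y≡p-q ⟩
    (p - q) + (y + q)   ≡⟨ regroup′ p q y ⟩
    p + y               ∎
    where
    open ≡-Reasoning
    regroup : ∀ x y q → x + q ≡ (x - y) + (y + q)
    regroup = solve-∀
    regroup′ : ∀ p q y → (p - q) + (y + q) ≡ p + y
    regroup′ = solve-∀
  parts : x ≡ 0ℤ ⊎ y ≡ 0ℤ → p ≡ 0ℤ ⊎ q ≡ 0ℤ → x ≡ p × y ≡ q
  parts (inj₁ refl) (inj₁ refl) = refl , sym (trans (sym (ℤP.+-identityˡ q)) (trans balance (ℤP.+-identityˡ y)))
  parts (inj₁ refl) (inj₂ refl) = let p≡0 , y≡0 = nonneg-+-zero p≥0 y≥0 (sym balance) in sym p≡0 , y≡0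
  parts (inj₂ refl) (inj₁ refl) = let x≡0 , q≡0 = nonneg-+-zero x≥0 q≥0 balance in x≡0 , sym q≡0
  parts (inj₂ refl) (inj₂ refl) = trans (sym (ℤP.+-identityʳ x)) (trans balance (ℤP.+-identityʳ p)) , refl

shift-into-range : ∀ {x N} → ∣ x ∣ ℕ.≤ N → 0ℤ ≤ x + + N × x + + N ≤ + (N ℕ.+ N)
shift-into-range {+ m}      {N} m≤N   = +≤+ ℕ.z≤n , +≤+ (ℕP.+-monoˡ-≤ N m≤N)
shift-into-range { -[1+ m ]} {N} 1+m≤N =
  subst (0ℤ ≤_) (sym (ℤP.⊖-≥ 1+m≤N)) (+≤+ ℕ.z≤n) , ℤP.≤-trans (ℤP.m⊖n≤m N (suc m)) (+≤+ (ℕP.m≤m+n N N))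

does-true : ∀ {P : Set} (P? : Dec P) → does P? ≡ true → P
does-true P? eq = invert (subst (Reflects _) eq (proof P?))

true-or-false : ∀ b → b ≡ true ⊎ b ≡ false
true-or-false true  = inj₁ refl
true-or-false false = inj₂ refl

∧-not-true : ∀ {s r} → s ∧ not r ≡ true → s ≡ true × r ≡ false
∧-not-true {true}  {false} _ = refl , refl
∧-not-true {true}  {true}  ()
∧-not-true {false}         ()

∧-not-false : ∀ {s r} → s ∧ not r ≡ false → s ≡ true → r ≡ true
∧-not-false {r = true}     _  _ = refl
∧-not-false {true} {false} () _

not-xor-not : ∀ x y → not x xor not y ≡ x xor y
not-xor-not x y = begin
  not x xor not y     ≡⟨ BP.not-distribˡ-xor x (not y) ⟨
  not (x xor not y)   ≡⟨ cong not (BP.not-distribʳ-xor x y) ⟨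
  not (not (x xor y)) ≡⟨ BP.not-involutive (x xor y) ⟩
  x xor y             ∎
  where open ≡-Reasoning

if-positive-cong : ∀ {b c} m → (0 < m → b ≡ c) → (if b then m else 0) ≡ (if c then m else 0)
if-positive-cong                 (suc m) b≡c = cong (λ x → if x then suc m else 0) (b≡c ℕ.z<s)
if-positive-cong {true}  {true}  zero    _   = refl
if-positive-cong {true}  {false} zero    _   = refl
if-positive-cong {false} {true}  zero    _   = refl
if-positive-cong {false} {false} zero    _   = refl

ΣFin-cong : ∀ {A : Set} {_⊕_ : A → A → A} {e : A} n {f g : Fin n → A} →
            (∀ i → f i ≡ g i) → ΣFin _⊕_ e n f ≡ ΣFin _⊕_ e n g
ΣFin-cong               zero    f≗g = refl
ΣFin-cong {_⊕_ = _⊕_} (suc n) f≗g = cong₂ _⊕_ (f≗g zero) (ΣFin-cong n (f≗g ∘ suc))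

ΣFin≡foldr : ∀ {A : Set} (_⊕_ : A → A → A) (e : A) n (f : Fin n → A) →
             ΣFin _⊕_ e n f ≡ foldr _⊕_ e f
ΣFin≡foldr _⊕_ e zero    f = refl
ΣFin≡foldr _⊕_ e (suc n) f = cong (f zero ⊕_) (ΣFin≡foldr _⊕_ e n (f ∘ suc))

+-sumℕ : ∀ n (f : Fin n → ℕ) → + sumℕ n f ≡ sum (+_ ∘ f)
+-sumℕ zero    f = refl
+-sumℕ (suc n) f = cong (_+_ (+ f zero)) (+-sumℕ n (f ∘ suc))

≤-sumℕ : ∀ n (f : Fin n → ℕ) i → f i ℕ.≤ sumℕ n f
≤-sumℕ (suc n) f zero    = ℕP.m≤m+n _ _
≤-sumℕ (suc n) f (suc i) = ℕP.≤-trans (≤-sumℕ n (f ∘ suc) i) (ℕP.m≤n+m _ _)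

sum-neg : ∀ {n} (f : Fin n → ℤ) → sum (λ i → - f i) ≡ - sum f
sum-neg f = begin
  sum (λ i → - f i)    ≡⟨ sum-cong-≗ (λ i → ℤP.-1*i≡-i (f i)) ⟨
  sum (λ i → -1ℤ * f i) ≡⟨ *-distribˡ-sum -1ℤ f ⟨
  -1ℤ * sum f          ≡⟨ ℤP.-1*i≡-i (sum f) ⟩
  - sum f              ∎
  where open ≡-Reasoning

sum-∸ : ∀ {n} (f g : Fin n → ℤ) → sum (λ i → f i - g i) ≡ sum f - sum g
sum-∸ f g = trans (∑-distrib-+ f (λ i → - g i)) (cong (_+_ (sum f)) (sum-neg g))

sum-mono-≤ : ∀ {n} {f g : Fin n → ℤ} → (∀ i → f i ≤ g i) → sum f ≤ sum g
sum-mono-≤ {zero}  f≤g = ℤP.≤-refl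
sum-mono-≤ {suc n} f≤g = ℤP.+-mono-≤ (f≤g zero) (sum-mono-≤ (f≤g ∘ suc))

sum-nonneg : ∀ {n} {f : Fin n → ℤ} → (∀ i → 0ℤ ≤ f i) → 0ℤ ≤ sum f
sum-nonneg {n} {f} f≥0 = subst (_≤ sum f) (sum-replicate-zero n) (sum-mono-≤ f≥0)

≤-sum : ∀ {n} {f : Fin n → ℤ} → (∀ i → 0ℤ ≤ f i) → ∀ i → f i ≤ sum f
≤-sum {suc n} {f} f≥0 zero    = ℤP.i≤i+j (f zero) _ {{ℤ.nonNegative (sum-nonneg (f≥0 ∘ suc))}}
≤-sum {suc n} {f} f≥0 (suc i) = ℤP.≤-trans (≤-sum (f≥0 ∘ suc) i) (ℤP.i≤j+i _ (f zero) {{ℤ.nonNegative (f≥0 zero)}})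

sum≢0⇒≢0 : ∀ {n} (f : Fin n → ℤ) → sum f ≢ 0ℤ → ∃ λ i → f i ≢ 0ℤ
sum≢0⇒≢0 {zero}  f sum≢0 = ⊥-elim (sum≢0 refl)
sum≢0⇒≢0 {suc n} f sum≢0 with f zero ℤP.≟ 0ℤ
... | no  f₀≢0 = zero , f₀≢0
... | yes f₀≡0 with sum≢0⇒≢0 (f ∘ suc) (λ rest≡0 → sum≢0 (cong₂ _+_ f₀≡0 rest≡0))
...   | i , fᵢ≢0 = suc i , fᵢ≢0

-- The Laplacian and firing

indicator : ∀ {n} → (Fin n → Bool) → Fin n → ℤ
indicator S v = if S v then 1ℤ else 0ℤ

atLeast : ∀ {n} → ℤ → (Fin n → ℤ) → Fin n → Bool
atLeast t f v = does (t ℤP.≤? f v)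

InRange : ∀ {n} → ℕ → (Fin n → ℤ) → Set
InRange k f = ∀ v → 0ℤ ≤ f v × f v ≤ + k

lower-top-level : ∀ {n k} {f : Fin n → ℤ} → InRange (suc k) f →
  InRange k (λ v → f v - indicator (atLeast (+ suc k) f) v)
lower-top-level {k = k} {f} range v with range v | + suc k ℤP.≤? f v
... | _    , fv≤1+k | yes 1+k≤fv rewrite ℤP.≤-antisym fv≤1+k 1+k≤fv = +≤+ ℕ.z≤n , ℤP.≤-refl
... | 0≤fv , _      | no  1+k≰fv rewrite ℤP.+-identityʳ (f v) = 0≤fv , ℤP.i<j⇒i≤pred[j] (ℤP.≰⇒> 1+k≰fv)

module _ {n : ℕ} (G : Graph n) where
  open ≡-Reasoning

  laplacian-as-sum : ∀ f v → laplacian G f v ≡ ∑[ u < n ] (+ w G v u * (f v - f u))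
  laplacian-as-sum f v = begin
    + deg G v * f v - sumℤ n (λ u → + w G v u * f u)
      ≡⟨ cong₂ (λ d s → d * f v - s) (+-sumℕ n (w G v)) (ΣFin≡foldr _ _ n _) ⟩
    ∑[ u < n ] (+ w G v u) * f v - ∑[ u < n ] (+ w G v u * f u)
      ≡⟨ cong (_- ∑[ u < n ] (+ w G v u * f u)) (*-distribʳ-sum (f v) (λ u → + w G v u)) ⟩
    ∑[ u < n ] (+ w G v u * f v) - ∑[ u < n ] (+ w G v u * f u)
      ≡⟨ sum-∸ {n} _ _ ⟨
    ∑[ u < n ] (+ w G v u * f v - + w G v u * f u)
      ≡⟨ sum-cong-≗ (λ u → factor (+ w G v u) (f v) (f u)) ⟩
    ∑[ u < n ] (+ w G v u * (f v - f u)) ∎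
    where
    factor : ∀ k x y → k * x - k * y ≡ k * (x - y)
    factor = solve-∀

  laplacian-const : ∀ {f c} → (∀ u → f u ≡ c) → ∀ v → laplacian G f v ≡ 0ℤ
  laplacian-const {f} {c} f≡c v = begin
    laplacian G f v                      ≡⟨ laplacian-as-sum f v ⟩
    ∑[ u < n ] (+ w G v u * (f v - f u)) ≡⟨ sum-cong-≗ vanish ⟩
    ∑[ _ < n ] 0ℤ                        ≡⟨ sum-replicate-zero n ⟩
    0ℤ                                   ∎
    where
    vanish : ∀ u → + w G v u * (f v - f u) ≡ 0ℤ
    vanish u = begin
      + w G v u * (f v - f u) ≡⟨ cong₂ (λ x y → + w G v u * (x - y)) (f≡c v) (f≡c u) ⟩
      + w G v u * (c - c)     ≡⟨ cong (+ w G v u *_) (ℤP.+-inverseʳ c) ⟩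
      + w G v u * 0ℤ          ≡⟨ ℤP.*-zeroʳ (+ w G v u) ⟩
      0ℤ                      ∎

  laplacian-shift : ∀ f c v → laplacian G (λ u → f u + c) v ≡ laplacian G f v
  laplacian-shift f c v = begin
    laplacian G (λ u → f u + c) v                      ≡⟨ laplacian-as-sum _ v ⟩
    ∑[ u < n ] (+ w G v u * ((f v + c) - (f u + c)))   ≡⟨ sum-cong-≗ (λ u → cancel (+ w G v u) (f v) (f u) c) ⟩
    ∑[ u < n ] (+ w G v u * (f v - f u))               ≡⟨ laplacian-as-sum f v ⟨
    laplacian G f v                                    ∎
    where
    cancel : ∀ k x y c → k * ((x + c) - (y + c)) ≡ k * (x - y)
    cancel = solve-∀

  laplacian-∸ : ∀ f g v → laplacian G (λ u → f u - g u) v ≡ laplacian G f v - laplacian G g v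
  laplacian-∸ f g v = begin
    laplacian G (λ u → f u - g u) v
      ≡⟨ laplacian-as-sum _ v ⟩
    ∑[ u < n ] (+ w G v u * ((f v - g v) - (f u - g u)))
      ≡⟨ sum-cong-≗ (λ u → split (+ w G v u) (f v) (g v) (f u) (g u)) ⟩
    ∑[ u < n ] (+ w G v u * (f v - f u) - + w G v u * (g v - g u))
      ≡⟨ sum-∸ {n} _ _ ⟩
    ∑[ u < n ] (+ w G v u * (f v - f u)) - ∑[ u < n ] (+ w G v u * (g v - g u))
      ≡⟨ cong₂ _-_ (laplacian-as-sum f v) (laplacian-as-sum g v) ⟨
    laplacian G f v - laplacian G g v ∎
    where
    split : ∀ k x y x′ y′ → k * ((x - y) - (x′ - y′)) ≡ k * (x - x′) - k * (y - y′)
    split = solve-∀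

  sum-laplacian : ∀ f → sum (laplacian G f) ≡ 0ℤ
  sum-laplacian f = begin
    sum (laplacian G f)
      ≡⟨ sum-cong-≗ (λ v → trans (laplacian-as-sum f v) (sum-cong-≗ (λ u → distrib (+ w G v u) (f v) (f u)))) ⟩
    ∑[ v < n ] (∑[ u < n ] (+ w G v u * f v - + w G v u * f u))
      ≡⟨ sum-cong-≗ {n} (λ v → sum-∸ {n} _ _) ⟩
    ∑[ v < n ] (out v - in′ v)
      ≡⟨ sum-∸ out in′ ⟩
    sum out - sum in′
      ≡⟨ cong (_-_ (sum out)) in≡out ⟩
    sum out - sum out
      ≡⟨ ℤP.+-inverseʳ (sum out) ⟩
    0ℤ ∎
    where
    distrib : ∀ k x y → k * (x - y) ≡ k * x - k * y
    distrib = solve-∀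
    out in′ : Fin n → ℤ
    out v = ∑[ u < n ] (+ w G v u * f v)
    in′ v = ∑[ u < n ] (+ w G v u * f u)
    in≡out : sum in′ ≡ sum out
    in≡out = trans (∑-comm (λ v u → + w G v u * f u))
                   (sum-cong-≗ (λ u → sum-cong-≗ (λ v → cong (λ m → + m * f u) (w-sym G v u))))

  fire : (Fin n → Bool) → Divisor n → Divisor n
  fire S E v = E v - laplacian G (indicator S) v

  laplacian-indicator-inside : ∀ S v → S v ≡ true → laplacian G (indicator S) v ≡ + degAB G S v
  laplacian-indicator-inside S v Sv = begin
    laplacian G (indicator S) v                               ≡⟨ laplacian-as-sum _ v ⟩
    ∑[ u < n ] (+ w G v u * (indicator S v - indicator S u))  ≡⟨ sum-cong-≗ (λ u → term (w G v u) (S v) (S u) Sv) ⟩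
    ∑[ u < n ] (+ (if S u xor S v then w G v u else 0))       ≡⟨ +-sumℕ n _ ⟨
    + degAB G S v                                             ∎
    where
    term : ∀ m x y → x ≡ true →
      + m * ((if x then 1ℤ else 0ℤ) - (if y then 1ℤ else 0ℤ)) ≡ + (if y xor x then m else 0)
    term m .true true  refl = ℤP.*-zeroʳ (+ m)
    term m .true false refl = ℤP.*-identityʳ (+ m)

  laplacian-indicator-outside : ∀ S v → S v ≡ false → laplacian G (indicator S) v ≡ - + degAB G S v
  laplacian-indicator-outside S v Sv = begin
    laplacian G (indicator S) v                               ≡⟨ laplacian-as-sum _ v ⟩
    ∑[ u < n ] (+ w G v u * (indicator S v - indicator S u))  ≡⟨ sum-cong-≗ (λ u → term (w G v u) (S v) (S u) Sv) ⟩
    ∑[ u < n ] (- + (if S u xor S v then w G v u else 0))     ≡⟨ sum-neg {n} _ ⟩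
    - ∑[ u < n ] (+ (if S u xor S v then w G v u else 0))     ≡⟨ cong -_ (+-sumℕ n _) ⟨
    - + degAB G S v                                           ∎
    where
    minus-one : ∀ k → k * (0ℤ - 1ℤ) ≡ - k
    minus-one = solve-∀
    term : ∀ m x y → x ≡ false →
      + m * ((if x then 1ℤ else 0ℤ) - (if y then 1ℤ else 0ℤ)) ≡ - + (if y xor x then m else 0)
    term m .false true  refl = minus-one (+ m)
    term m .false false refl = ℤP.*-zeroʳ (+ m)

  fire-inside : ∀ S E v → S v ≡ true → fire S E v ≡ E v - + degAB G S v
  fire-inside S E v Sv = cong (_-_ (E v)) (laplacian-indicator-inside S v Sv)

  fire-outside : ∀ S E v → S v ≡ false → fire S E v ≡ E v + + degAB G S v
  fire-outside S E v Sv = cong (_+_ (E v)) (trans (cong -_ (laplacian-indicator-outside S v Sv)) (ℤP.neg-involutive _))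

  ∼-respˡ-≗ : ∀ {E E′ F} → (∀ v → E v ≡ E′ v) → _∼_ G E F → _∼_ G E′ F
  ∼-respˡ-≗ {F = F} E≗E′ (f , E-F≡Lf) = f , λ v → trans (cong (_- F v) (sym (E≗E′ v))) (E-F≡Lf v)

  ∼-leftEuclidean : ∀ {E F D} → _∼_ G E D → _∼_ G F D → _∼_ G E F
  ∼-leftEuclidean {E} {F} {D} (f , E-D≡Lf) (g , F-D≡Lg) = (λ u → f u - g u) , λ v → begin
    E v - F v                         ≡⟨ cancel (E v) (F v) (D v) ⟩
    (E v - D v) - (F v - D v)         ≡⟨ cong₂ _-_ (E-D≡Lf v) (F-D≡Lg v) ⟩
    laplacian G f v - laplacian G g v ≡⟨ laplacian-∸ f g v ⟨
    laplacian G (λ u → f u - g u) v   ∎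
    where
    cancel : ∀ x y z → x - y ≡ (x - z) - (y - z)
    cancel = solve-∀

  fire-∼ : ∀ S {E F} → _∼_ G E F → _∼_ G (fire S E) F
  fire-∼ S {E} {F} E∼F = (λ u → f u - indicator S u) , λ v → begin
    fire S E v - F v                         ≡⟨ reorder (E v) (Lχ v) (F v) ⟩
    (E v - F v) - Lχ v                       ≡⟨ cong (_- Lχ v) (proj₂ E∼F v) ⟩
    laplacian G f v - Lχ v                   ≡⟨ laplacian-∸ f (indicator S) v ⟨
    laplacian G (λ u → f u - indicator S u) v ∎
    where
    f : Fin n → ℤ
    f = proj₁ E∼F
    Lχ : Fin n → ℤ
    Lχ = laplacian G (indicator S)
    reorder : ∀ x y z → (x - y) - z ≡ (x - z) - y
    reorder = solve-∀

  ∼-sum : ∀ {E F} → _∼_ G E F → sum E ≡ sum F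
  ∼-sum {E} {F} (f , E-F≡Lf) = ℤP.i-j≡0⇒i≡j _ _ (begin
    sum E - sum F         ≡⟨ sum-∸ E F ⟨
    ∑[ v < n ] (E v - F v) ≡⟨ sum-cong-≗ E-F≡Lf ⟩
    sum (laplacian G f)   ≡⟨ sum-laplacian f ⟩
    0ℤ                    ∎)

module _ {n : ℕ} (G : Graph n) where
  open ℤP.≤-Reasoning

  ≤-fire-outside : ∀ S E v → S v ≡ false → E v ≤ fire G S E v
  ≤-fire-outside S E v Sv = ℤP.≤-trans (ℤP.i≤i+j (E v) (+ degAB G S v)) (ℤP.≤-reflexive (sym (fire-outside G S E v Sv)))

  degAB-≤-fire-outside : ∀ S E v → 0ℤ ≤ E v → S v ≡ false → + degAB G S v ≤ fire G S E v
  degAB-≤-fire-outside S E v Ev≥0 Sv =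
    ℤP.≤-trans (ℤP.i≤j+i (+ degAB G S v) (E v) {{ℤ.nonNegative Ev≥0}}) (ℤP.≤-reflexive (sym (fire-outside G S E v Sv)))

  -- Termwise: at a maximum v of f, indicator v − indicator u is 0 when f u = t and 1 ≤ t − f u otherwise.
  laplacian-indicator-atLeast-≤ : ∀ {t f v} → (∀ u → f u ≤ t) → t ≤ f v →
    laplacian G (indicator (atLeast t f)) v ≤ laplacian G f v
  laplacian-indicator-atLeast-≤ {t} {f} {v} f≤t t≤fv = begin
    laplacian G (indicator S) v                               ≡⟨ laplacian-as-sum G _ v ⟩
    ∑[ u < n ] (+ w G v u * (indicator S v - indicator S u))
      ≤⟨ sum-mono-≤ (λ u → ℤP.*-monoˡ-≤-nonNeg (+ w G v u) (gap u)) ⟩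
    ∑[ u < n ] (+ w G v u * (f v - f u))                      ≡⟨ laplacian-as-sum G f v ⟨
    laplacian G f v                                           ∎
    where
    S : Fin n → Bool
    S = atLeast t f
    fv≡t : f v ≡ t
    fv≡t = ℤP.≤-antisym (f≤t v) t≤fv
    cancel : ∀ x → (1ℤ + x) - x ≡ 1ℤ
    cancel = solve-∀
    gap : ∀ u → indicator S v - indicator S u ≤ f v - f u
    gap u with t ℤP.≤? f v | t ℤP.≤? f u
    ... | no t≰fv | _        = contradiction t≤fv t≰fv
    ... | yes _   | yes t≤fu = ℤP.≤-reflexive (sym (begin-equality
      f v - f u ≡⟨ cong₂ _-_ fv≡t (ℤP.≤-antisym (f≤t u) t≤fu) ⟩
      t - t     ≡⟨ ℤP.+-inverseʳ t ⟩
      0ℤ        ∎))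
    ... | yes _   | no t≰fu  = begin
      1ℤ               ≡⟨ cancel (f u) ⟨
      (1ℤ + f u) - f u ≤⟨ ℤP.+-monoˡ-≤ (- f u) (ℤP.i<j⇒suc[i]≤j fu<fv) ⟩
      f v - f u        ∎
      where
      fu<fv : f u ℤ.< f v
      fu<fv = subst (f u ℤ.<_) (sym fv≡t) (ℤP.≰⇒> t≰fu)

  fire-atLeast-effective : ∀ {t f E E′} → (∀ u → f u ≤ t) → (∀ v → E v - E′ v ≡ laplacian G f v) →
    Effective G E → Effective G E′ → Effective G (fire G (atLeast t f) E)
  fire-atLeast-effective {t} {f} {E} {E′} f≤t E-E′≡Lf E≥0 E′≥0 v = by-side (atLeast t f v) refl
    where
    shift : ∀ x y → y ≡ x - (x - y)
    shift = solve-∀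
    by-side : ∀ b → atLeast t f v ≡ b → 0ℤ ≤ fire G (atLeast t f) E v
    by-side false Sv = ℤP.≤-trans (E≥0 v) (≤-fire-outside _ E v Sv)
    by-side true  Sv = begin
      0ℤ                       ≤⟨ E′≥0 v ⟩
      E′ v                     ≡⟨ shift (E v) (E′ v) ⟩
      E v - (E v - E′ v)       ≡⟨ cong (_-_ (E v)) (E-E′≡Lf v) ⟩
      E v - laplacian G f v    ≤⟨ ℤP.+-monoʳ-≤ (E v) (ℤP.neg-mono-≤ (laplacian-indicator-atLeast-≤ f≤t t≤fv)) ⟩
      fire G (atLeast t f) E v ∎
      where
      t≤fv : t ≤ f v
      t≤fv = does-true (t ℤP.≤? f v) Sv

-- Boundary divisors of a bipartition

module _ {n : ℕ} (G : Graph n) where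

  InSupp-resp-≗ : ∀ {E F v} → (∀ u → E u ≡ F u) → InSupp G E v → InSupp G F v
  InSupp-resp-≗ {v = v} E≗F = subst (_≢ 0ℤ) (E≗F v)

  0<degAB : ∀ S {u v} → 0 < w G u v → S v xor S u ≡ true → 0 < degAB G S u
  0<degAB S {u} {v} uv Sv⊕Su = ℕP.<-≤-trans uv
    (subst (ℕ._≤ degAB G S u) (cong (λ c → if c then w G u v else 0) Sv⊕Su) (≤-sumℕ n _ v))

  +degAB≢0 : ∀ S {u v} → 0 < w G u v → S v xor S u ≡ true → + degAB G S u ≢ 0ℤ
  +degAB≢0 S uv Sv⊕Su = ℕP.n>0⇒n≢0 (0<degAB S uv Sv⊕Su) ∘ ℤP.+-injective

  degAB-not : ∀ S v → degAB G (not ∘ S) v ≡ degAB G S v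
  degAB-not S v = ΣFin-cong n (λ u → cong (λ c → if c then w G v u else 0) (not-xor-not (S u) (S v)))

  boundary-not : ∀ S b v → boundary G (not ∘ S) b v ≡ boundary G S (not b) v
  boundary-not S b v = cong₂ (λ c d → if c then 0ℤ else + d)
    (trans (sym (BP.not-distribˡ-xor (S v) b)) (BP.not-distribʳ-xor (S v) b)) (degAB-not S v)

  boundary-on-side : ∀ S b v → S v ≡ b → boundary G S b v ≡ + degAB G S v
  boundary-on-side S true  v Sv = cong (λ c → if c xor true  then 0ℤ else + degAB G S v) Sv
  boundary-on-side S false v Sv = cong (λ c → if c xor false then 0ℤ else + degAB G S v) Sv

  boundary-off-side : ∀ S b v → S v ≡ not b → boundary G S b v ≡ 0ℤ
  boundary-off-side S true  v Sv = cong (λ c → if c xor true  then 0ℤ else + degAB G S v) Sv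
  boundary-off-side S false v Sv = cong (λ c → if c xor false then 0ℤ else + degAB G S v) Sv

  boundary-nonneg : ∀ S b v → 0ℤ ≤ boundary G S b v
  boundary-nonneg S b v with S v BP.≟ b
  ... | yes Sv≡b = subst (0ℤ ≤_) (sym (boundary-on-side S b v Sv≡b)) (+≤+ ℕ.z≤n)
  ... | no  Sv≢b = ℤP.≤-reflexive (sym (boundary-off-side S b v (BP.¬-not Sv≢b)))

  boundary-disjoint : ∀ S v → boundary G S true v ≡ 0ℤ ⊎ boundary G S false v ≡ 0ℤ
  boundary-disjoint S v with true-or-false (S v)
  ... | inj₁ Sv = inj₂ (boundary-off-side S false v Sv)
  ... | inj₂ Sv = inj₁ (boundary-off-side S true v Sv)

  laplacian-indicator-boundary : ∀ S v → laplacian G (indicator S) v ≡ boundary G S true v - boundary G S false v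
  laplacian-indicator-boundary S v with true-or-false (S v)
  ... | inj₁ Sv = begin
    laplacian G (indicator S) v                ≡⟨ laplacian-indicator-inside G S v Sv ⟩
    + degAB G S v                              ≡⟨ ℤP.+-identityʳ _ ⟨
    + degAB G S v - 0ℤ                         ≡⟨ cong₂ _-_ (boundary-on-side S true v Sv) (boundary-off-side S false v Sv) ⟨
    boundary G S true v - boundary G S false v ∎
    where open ≡-Reasoning
  ... | inj₂ Sv = begin
    laplacian G (indicator S) v                ≡⟨ laplacian-indicator-outside G S v Sv ⟩
    - + degAB G S v                            ≡⟨ ℤP.+-identityˡ _ ⟨
    0ℤ - + degAB G S v                         ≡⟨ cong₂ _-_ (boundary-off-side S true v Sv) (boundary-on-side S false v Sv) ⟨
    boundary G S true v - boundary G S false v ∎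
    where open ≡-Reasoning

  fire-boundaries : ∀ S {X} → Effective G X → Effective G (fire G S X) →
    (∀ v → X v ≡ 0ℤ ⊎ fire G S X v ≡ 0ℤ) →
    ∀ v → X v ≡ boundary G S true v × fire G S X v ≡ boundary G S false v
  fire-boundaries S {X} X≥0 Y≥0 X∨Y v = difference-parts-unique (X≥0 v) (Y≥0 v)
    (boundary-nonneg S true v) (boundary-nonneg S false v) (X∨Y v) (boundary-disjoint S v)
    (trans (cancel (X v) _) (laplacian-indicator-boundary S v))
    where
    cancel : ∀ x l → x - (x - l) ≡ l
    cancel = solve-∀

  boundary-supp⇒side : ∀ S b {v} → InSupp G (boundary G S b) v → S v ≡ b
  boundary-supp⇒side S b {v} Bv with S v BP.≟ b
  ... | yes Sv≡b = Sv≡b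
  ... | no  Sv≢b = contradiction (boundary-off-side S b v (BP.¬-not Sv≢b)) Bv

  side⇒boundary-supp : ∀ S b {u v} → 0 < w G u v → S u ≡ b → S v xor S u ≡ true → InSupp G (boundary G S b) u
  side⇒boundary-supp S b {u} uv Su Sv⊕Su = +degAB≢0 S uv Sv⊕Su ∘ trans (sym (boundary-on-side S b u Su))

  boundary-between : ∀ S {u v} → 0 < w G u v →
    Between G (InSupp G (boundary G S true)) (InSupp G (boundary G S false)) u v ⇔ Between G (InA G S) (InB G S) u v
  boundary-between S {u} {v} uv = mk⇔ to from
    where
    vu : 0 < w G v u
    vu = subst (0 <_) (w-sym G u v) uv
    to : Between G (InSupp G (boundary G S true)) (InSupp G (boundary G S false)) u v → Between G (InA G S) (InB G S) u v
    to (inj₁ (Au , Bv)) = inj₁ (boundary-supp⇒side S true Au , boundary-supp⇒side S false Bv)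
    to (inj₂ (Bu , Av)) = inj₂ (boundary-supp⇒side S false Bu , boundary-supp⇒side S true Av)
    from : Between G (InA G S) (InB G S) u v → Between G (InSupp G (boundary G S true)) (InSupp G (boundary G S false)) u v
    from (inj₁ (Au , Bv)) = inj₁ ( side⇒boundary-supp S true  uv Au (cong₂ _xor_ Bv Au)
                                 , side⇒boundary-supp S false vu Bv (cong₂ _xor_ Au Bv))
    from (inj₂ (Bu , Av)) = inj₂ ( side⇒boundary-supp S false uv Bu (cong₂ _xor_ Av Bu)
                                 , side⇒boundary-supp S true  vu Av (cong₂ _xor_ Bu Av))

  supp-between : ∀ {X Y S u v} → (∀ u → X u ≡ boundary G S true u) → (∀ u → Y u ≡ boundary G S false u) →
    0 < w G u v → Between G (InSupp G X) (InSupp G Y) u v ⇔ Between G (InA G S) (InB G S) u v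
  supp-between {X} {Y} {S} X≗ Y≗ uv = mk⇔
    (Equivalence.to (boundary-between S uv) ∘ Sum.map (Product.map (InSupp-resp-≗ X≗) (InSupp-resp-≗ Y≗))
                                                      (Product.map (InSupp-resp-≗ Y≗) (InSupp-resp-≗ X≗)))
    (Sum.map (Product.map (InSupp-resp-≗ (sym ∘ X≗)) (InSupp-resp-≗ (sym ∘ Y≗)))
             (Product.map (InSupp-resp-≗ (sym ∘ Y≗)) (InSupp-resp-≗ (sym ∘ X≗))) ∘ Equivalence.from (boundary-between S uv))

-- Components

module _ {n : ℕ} (G : Graph n) where

  PathIn-end : ∀ {X a v} → PathIn G X a v → X v
  PathIn-end (here Xv)       = Xv
  PathIn-end (step _ _ rest) = PathIn-end rest

  PathIn-snoc : ∀ {X a u v} → PathIn G X a u → X v → 0 < w G u v → PathIn G X a v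
  PathIn-snoc (here Xu)          Xv uv = step Xu uv (here Xv)
  PathIn-snoc (step Xa aa′ rest) Xv uv = step Xa aa′ (PathIn-snoc rest Xv uv)

  PathIn-map : ∀ {X Y : Fin n → Set} → (∀ v → X v → Y v) → ∀ {a b} → PathIn G X a b → PathIn G Y a b
  PathIn-map X⊆Y (here Xa)          = here (X⊆Y _ Xa)
  PathIn-map X⊆Y (step Xa aa′ rest) = step (X⊆Y _ Xa) aa′ (PathIn-map X⊆Y rest)

  exit-edge : ∀ {X a c} (P : Fin n → Bool) → PathIn G X a c → P a ≡ true → P c ≡ false →
    ∃ λ x → ∃ λ y → P x ≡ true × P y ≡ false × 0 < w G x y
  exit-edge P (here _) Pa Pc = ⊥-elim (BP.not-¬ Pa Pc)
  exit-edge P (step {u} {v} _ uv rest) Pu Pc with P v in Pv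
  ... | true  = exit-edge P rest Pv Pc
  ... | false = u , v , Pu , Pv , uv

  record Component (S : Fin n → Bool) (a : Fin n) : Set where
    field
      R      : Fin n → Bool
      root   : R a ≡ true
      path   : ∀ {v} → R v ≡ true → PathIn G (InA G S) a v
      closed : ∀ {u v} → R u ≡ true → S v ≡ true → 0 < w G u v → R v ≡ true

  component : ∀ S {a} → S a ≡ true → Component S a
  component S {a} Sa = grow ⁅ a ⁆ (⊃-wellFounded _) (x∈⁅x⁆ a) (λ v∈⁅a⁆ → at v∈⁅a⁆ (here Sa))
    where
    Reaches : Subset n → Set
    Reaches R = ∀ {v} → v ∈ R → PathIn G (InA G S) a v
    at : ∀ {x y} → x ∈ ⁅ y ⁆ → PathIn G (InA G S) a y → PathIn G (InA G S) a x
    at {y = y} x∈⁅y⁆ = subst (PathIn G (InA G S) a) (sym (x∈⁅y⁆⇒x≡y y x∈⁅y⁆))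
    grow : (R : Subset n) → Acc _⊃_ R → a ∈ R → Reaches R → Component S a
    grow R (acc larger) a∈R reaches
      with any? (λ u → any? (λ v → u ∈? R ×-dec ¬? (v ∈? R) ×-dec S v BP.≟ true ×-dec 0 ℕ.<? w G u v))
    ... | yes (u , v , u∈R , v∉R , Sv , uv) =
      grow (R ∪ ⁅ v ⁆) (larger (p⊆p∪q ⁅ v ⁆ , v , q⊆p∪q R ⁅ v ⁆ (x∈⁅x⁆ v) , v∉R))
           (p⊆p∪q ⁅ v ⁆ a∈R) reaches′
      where
      reaches′ : Reaches (R ∪ ⁅ v ⁆)
      reaches′ x∈R∪v with x∈p∪q⁻ R ⁅ v ⁆ x∈R∪v
      ... | inj₁ x∈R   = reaches x∈R
      ... | inj₂ x∈⁅v⁆ = at x∈⁅v⁆ (PathIn-snoc (reaches u∈R) Sv uv)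
    ... | no no-exit = record
      { R      = λ v → does (v ∈? R)
      ; root   = dec-true (a ∈? R) a∈R
      ; path   = λ {v} Rv → reaches (does-true (v ∈? R) Rv)
      ; closed = λ {u} {v} Ru Sv uv → dec-true (v ∈? R) (decidable-stable (v ∈? R)
          λ v∉R → no-exit (u , v , does-true (u ∈? R) Ru , v∉R , Sv , uv))
      }

module _ {n : ℕ} (G : Graph n) {S : Fin n → Bool} {a : Fin n} (C : Component G S a) where
  open Component C

  component-⊆ : ∀ {v} → R v ≡ true → S v ≡ true
  component-⊆ Rv = PathIn-end G (path Rv)

  degAB-component : ∀ {v} → R v ≡ true → degAB G R v ≡ degAB G S v
  degAB-component {v} Rv = ΣFin-cong n λ u → if-positive-cong (w G v u) λ vu →
    cong₂ _xor_ (BP.⇔→≡ (mk⇔ component-⊆ λ Su → closed Rv Su vu)) (trans Rv (sym (component-⊆ Rv)))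

  fire-component-effective : ∀ {X} → Effective G X → (∀ v → X v ≡ boundary G S true v) → Effective G (fire G R X)
  fire-component-effective {X} X≥0 X≗ v with true-or-false (R v)
  ... | inj₂ Rv = ℤP.≤-trans (X≥0 v) (≤-fire-outside G R X v Rv)
  ... | inj₁ Rv = ℤP.≤-reflexive (sym (begin
    fire G R X v                     ≡⟨ fire-inside G R X v Rv ⟩
    X v - + degAB G R v              ≡⟨ cong₂ _-_ Xv≡degAB (cong +_ (degAB-component Rv)) ⟩
    + degAB G S v - + degAB G S v    ≡⟨ ℤP.+-inverseʳ (+ degAB G S v) ⟩
    0ℤ                               ∎))
    where
    open ≡-Reasoning
    Xv≡degAB : X v ≡ + degAB G S v
    Xv≡degAB = trans (X≗ v) (boundary-on-side G S true v (component-⊆ Rv))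

  exit-from-component : Connected G → ∀ {c} → S c ≡ false →
    ∃ λ x → ∃ λ y → R x ≡ true × S y ≡ false × 0 < w G x y
  exit-from-component connected {c} Sc with exit-edge G R (connected a c) root Rc
    where
    Rc : R c ≡ false
    Rc = BP.¬-not λ Rc → BP.not-¬ (component-⊆ Rc) Sc
  ... | x , y , Rx , Ry , xy = x , y , Rx , Sy , xy
    where
    Sy : S y ≡ false
    Sy = BP.¬-not λ Sy → BP.not-¬ (closed Rx Sy xy) Ry

  exit-from-rest : Connected G → ∀ {b c} → S b ≡ true → R b ≡ false → S c ≡ false →
    ∃ λ x → ∃ λ y → S x ≡ true × R x ≡ false × S y ≡ false × 0 < w G x y
  exit-from-rest connected {b} {c} Sb Rb Sc
    with exit-edge G (λ v → S v ∧ not (R v)) (connected b c) (cong₂ (λ s r → s ∧ not r) Sb Rb) (cong (_∧ not (R c)) Sc)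
  ... | x , y , x∈S∖R , y∉S∖R , xy = x , y , Sx , Rx , Sy , xy
    where
    Sx : S x ≡ true
    Sx = proj₁ (∧-not-true x∈S∖R)
    Rx : R x ≡ false
    Rx = proj₂ (∧-not-true x∈S∖R)
    Sy : S y ≡ false
    Sy = BP.¬-not λ Sy → BP.not-¬ (closed (∧-not-false y∉S∖R Sy) Sx (subst (0 <_) (w-sym G x y) xy)) Rx

-- Splittings

swap-splitting : ∀ {n} {G : Graph n} {D 𝒜 ℬ} → Splitting G D 𝒜 ℬ → Splitting G D ℬ 𝒜
swap-splitting splitting = record
  { 𝒜⊆         = ℬ⊆
  ; ℬ⊆         = 𝒜⊆
  ; cover      = λ D′ D′∈|D| → Sum.swap (cover D′ D′∈|D|)
  ; disjoint   = λ D′ D′∈ℬ D′∈𝒜 → disjoint D′ D′∈𝒜 D′∈ℬ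
  ; 𝒜-nonempty = ℬ-nonempty
  ; ℬ-nonempty = 𝒜-nonempty
  ; compatible = λ c c∈Δ D₁ D₂ D₁∈C D₂∈C → Sum.swap (compatible c c∈Δ D₁ D₂ D₁∈C D₂∈C)
  }
  where open Splitting splitting

members-supported : ∀ {n} {G : Graph n} {D X₀ c} → InLinSys G D X₀ → InSupp G X₀ c →
  ∀ {X} → InLinSys G D X → ∃ (InSupp G X)
members-supported {G = G} {D} {X₀} {c} (X₀≥0 , X₀∼D) X₀c {X} (_ , X∼D) = sum≢0⇒≢0 X λ ∑X≡0 →
  ≢0-mono-≤ (X₀≥0 c) (≤-sum X₀≥0 c) X₀c (trans (∼-sum G X₀∼D) (trans (sym (∼-sum G X∼D)) ∑X≡0))

module _ {n} {G : Graph n} {D : Divisor n} {𝒜 ℬ : Divisor n → Set} (splitting : Splitting G D 𝒜 ℬ) where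
  open Splitting splitting

  same-class : ∀ {X Y c} → InLinSys G D X → InLinSys G D Y → InSupp G X c → InSupp G Y c →
    (𝒜 X × 𝒜 Y) ⊎ (ℬ X × ℬ Y)
  same-class {X} {Y} {c} X∈|D| Y∈|D| Xc Yc =
    compatible c (X , X∈|D| , Xc) X Y (composing X∈|D| Xc) (composing Y∈|D| Yc)
    where
    composing : ∀ {Z} → InLinSys G D Z → InSupp G Z c → Composing G D c Z
    composing {Z} Z∈|D| Zc = Z∈|D| , λ v Zv → ConnΔ.step (Z , Z∈|D| , Zc , Zv) (ConnΔ.refl (Z , Z∈|D| , Zv))

  supports-disjoint : ∀ {X Y v} → 𝒜 X → ℬ Y → InSupp G X v → InSupp G Y v → ⊥
  supports-disjoint {X} {Y} X∈𝒜 Y∈ℬ Xv Yv with same-class (𝒜⊆ X X∈𝒜) (ℬ⊆ Y Y∈ℬ) Xv Yv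
  ... | inj₁ (_ , Y∈𝒜) = disjoint Y Y∈𝒜 Y∈ℬ
  ... | inj₂ (X∈ℬ , _) = disjoint X X∈𝒜 X∈ℬ

  one-vanishes : ∀ {X Y} → 𝒜 X → ℬ Y → ∀ v → X v ≡ 0ℤ ⊎ Y v ≡ 0ℤ
  one-vanishes {X} {Y} X∈𝒜 Y∈ℬ v with X v ℤP.≟ 0ℤ | Y v ℤP.≟ 0ℤ
  ... | yes Xv≡0 | _        = inj₁ Xv≡0
  ... | no  _    | yes Yv≡0 = inj₂ Yv≡0
  ... | no  Xv   | no  Yv   = ⊥-elim (supports-disjoint X∈𝒜 Y∈ℬ Xv Yv)

  Crossing : Set
  Crossing = Σ (Divisor n) λ X → Σ (Fin n → Bool) λ S → 𝒜 X × ℬ (fire G S X)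

  module _ (supported : ∀ {X} → InLinSys G D X → ∃ (InSupp G X)) {E′} (E′∈ℬ : ℬ E′) where

    crossing-from : ∀ k {E} → 𝒜 E → (E∼E′ : _∼_ G E E′) → InRange k (proj₁ E∼E′) → Crossing
    crossing-from zero {E} E∈𝒜 (f , E-E′≡Lf) range = ⊥-elim (supports-disjoint E∈𝒜 E′∈ℬ Ec E′c)
      where
      c : Fin n
      c = proj₁ (supported (𝒜⊆ E E∈𝒜))
      Ec : InSupp G E c
      Ec = proj₂ (supported (𝒜⊆ E E∈𝒜))
      f≡0 : ∀ u → f u ≡ 0ℤ
      f≡0 u = ℤP.≤-antisym (proj₂ (range u)) (proj₁ (range u))
      E′c : InSupp G E′ c
      E′c E′c≡0 = Ec (trans (ℤP.i-j≡0⇒i≡j (E c) (E′ c) (trans (E-E′≡Lf c) (laplacian-const G f≡0 c))) E′c≡0)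
    crossing-from (suc k) {E} E∈𝒜 E∼E′ range with cover (fire G S E) fire-S-E∈|D|
      where
      S : Fin n → Bool
      S = atLeast (+ suc k) (proj₁ E∼E′)
      fire-S-E∈|D| : InLinSys G D (fire G S E)
      fire-S-E∈|D| =
        fire-atLeast-effective G (proj₂ ∘ range) (proj₂ E∼E′) (proj₁ (𝒜⊆ E E∈𝒜)) (proj₁ (ℬ⊆ E′ E′∈ℬ)) ,
        fire-∼ G S {E} {D} (proj₂ (𝒜⊆ E E∈𝒜))
    ... | inj₂ fire-S-E∈ℬ = E , _ , E∈𝒜 , fire-S-E∈ℬ
    ... | inj₁ fire-S-E∈𝒜 = crossing-from k fire-S-E∈𝒜 (fire-∼ G _ {E} {E′} E∼E′) (lower-top-level range)

    crossing : ∀ {E} → 𝒜 E → Crossing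
    crossing {E} E∈𝒜 =
      crossing-from (N ℕ.+ N) E∈𝒜 shifted (λ v → shift-into-range {g v} (≤-sumℕ n (∣_∣ ∘ g) v))
      where
      E∼E′ : _∼_ G E E′
      E∼E′ = ∼-leftEuclidean G {E} {E′} {D} (proj₂ (𝒜⊆ E E∈𝒜)) (proj₂ (ℬ⊆ E′ E′∈ℬ))
      g : Fin n → ℤ
      g = proj₁ E∼E′
      N : ℕ
      N = sumℕ n (∣_∣ ∘ g)
      shifted : _∼_ G E E′
      shifted = (λ v → g v + + N) , λ v → trans (proj₂ E∼E′ v) (sym (laplacian-shift G g (+ N) v))

  component-spans : Connected G → ∀ {X Y S} → 𝒜 X → ℬ Y →
    (∀ v → X v ≡ boundary G S true v) → (∀ v → Y v ≡ boundary G S false v) →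
    ∀ {a b c} (C : Component G S a) → S b ≡ true → S c ≡ false → Component.R C b ≡ true
  component-spans connected {X} {Y} {S} X∈𝒜 Y∈ℬ X≗ Y≗ {a} {b} {c} C Sb Sc =
    Sum.[ id , (λ Rb → ⊥-elim (Sum.[ meets-Y , meets-X Rb ]′ (cover Z Z∈|D|))) ]′ (true-or-false (R b))
    where
    open Component C
    X∈|D| : InLinSys G D X
    X∈|D| = 𝒜⊆ X X∈𝒜
    Z : Divisor n
    Z = fire G R X
    Z∈|D| : InLinSys G D Z
    Z∈|D| = fire-component-effective G C (proj₁ X∈|D|) X≗ , fire-∼ G R {X} {D} (proj₂ X∈|D|)
    meets-Y : 𝒜 Z → ⊥
    meets-Y Z∈𝒜 with exit-from-component G C connected Sc
    ... | x , y , Rx , Sy , xy = supports-disjoint Z∈𝒜 Y∈ℬ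
      (≢0-mono-≤ (+≤+ ℕ.z≤n) (degAB-≤-fire-outside G R X y (proj₁ X∈|D| y) Ry)
                 (+degAB≢0 G R yx (cong₂ _xor_ Rx Ry)))
      (InSupp-resp-≗ G (sym ∘ Y≗) (side⇒boundary-supp G S false yx Sy (cong₂ _xor_ (component-⊆ G C Rx) Sy)))
      where
      yx : 0 < w G y x
      yx = subst (0 <_) (w-sym G x y) xy
      Ry : R y ≡ false
      Ry = BP.¬-not λ Ry → BP.not-¬ (component-⊆ G C Ry) Sy
    meets-X : R b ≡ false → ℬ Z → ⊥
    meets-X Rb Z∈ℬ with exit-from-rest G C connected Sb Rb Sc
    ... | x , y , Sx , Rx , Sy , xy = supports-disjoint X∈𝒜 Z∈ℬ Xx
      (≢0-mono-≤ (proj₁ X∈|D| x) (≤-fire-outside G R X x Rx) Xx)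
      where
      Xx : InSupp G X x
      Xx = InSupp-resp-≗ G (sym ∘ X≗) (side⇒boundary-supp G S true xy Sx (cong₂ _xor_ Sy Sx))

  side-connected : Connected G → ∀ {X Y S} → 𝒜 X → ℬ Y →
    (∀ v → X v ≡ boundary G S true v) → (∀ v → Y v ≡ boundary G S false v) →
    ∃ (InB G S) → InducesConnected G (InA G S)
  side-connected connected X∈𝒜 Y∈ℬ X≗ Y≗ (c , Sc) a b Sa Sb =
    Component.path C (component-spans connected X∈𝒜 Y∈ℬ X≗ Y≗ C Sb Sc)
    where
    C : Component G _ a
    C = component G _ Sa

boundary-cut : ∀ {n} {G : Graph n} {D 𝒜 ℬ} → Splitting G D 𝒜 ℬ → Connected G → ∀ {X Y S} → 𝒜 X → ℬ Y →
  (∀ v → X v ≡ boundary G S true v) → (∀ v → Y v ≡ boundary G S false v) →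
  ∃ (InA G S) → ∃ (InB G S) → IsCut G S
boundary-cut {G = G} splitting connected {X} {Y} {S} X∈𝒜 Y∈ℬ X≗ Y≗ (a , Sa) (b , Sb) =
  (a , Sa) , (b , Sb) , side-connected splitting connected X∈𝒜 Y∈ℬ X≗ Y≗ (b , Sb) , B-connected
  where
  B-connected : InducesConnected G (InB G S)
  B-connected u v Su Sv = PathIn-map G (λ _ → BP.not-injective)
    (side-connected (swap-splitting splitting) connected Y∈ℬ X∈𝒜
      (λ v → trans (Y≗ v) (sym (boundary-not G S true v))) (λ v → trans (X≗ v) (sym (boundary-not G S false v)))
      (a , cong not Sa) u v (cong not Su) (cong not Sv))

module _ {n} {G : Graph n} {D : Divisor n} {𝒜 ℬ : Divisor n → Set} (splitting : Splitting G D 𝒜 ℬ) where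
  open Splitting splitting

  crossing-cut : Connected G → (∀ {E} → InLinSys G D E → ∃ (InSupp G E)) →
    ∀ {X S} → 𝒜 X → ℬ (fire G S X) →
    IsCut G S ×
    (∀ u v → 0 < w G u v → Between G (InSupp G X) (InSupp G (fire G S X)) u v ⇔ Between G (InA G S) (InB G S) u v) ×
    _∼_ G (boundary G S true) D × _∼_ G (boundary G S false) D
  crossing-cut connected supported {X} {S} X∈𝒜 Y∈ℬ =
    boundary-cut splitting connected X∈𝒜 Y∈ℬ X≗A Y≗B (side-of X∈|D| X≗A) (side-of Y∈|D| Y≗B) ,
    (λ u v → supp-between G {S = S} X≗A Y≗B) ,
    ∼-respˡ-≗ G X≗A (proj₂ X∈|D|) , ∼-respˡ-≗ G Y≗B (proj₂ Y∈|D|)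
    where
    Y : Divisor n
    Y = fire G S X
    X∈|D| : InLinSys G D X
    X∈|D| = 𝒜⊆ X X∈𝒜
    Y∈|D| : InLinSys G D Y
    Y∈|D| = ℬ⊆ Y Y∈ℬ
    boundaries : ∀ v → X v ≡ boundary G S true v × Y v ≡ boundary G S false v
    boundaries = fire-boundaries G S (proj₁ X∈|D|) (proj₁ Y∈|D|) (one-vanishes splitting X∈𝒜 Y∈ℬ)
    X≗A : ∀ v → X v ≡ boundary G S true v
    X≗A = proj₁ ∘ boundaries
    Y≗B : ∀ v → Y v ≡ boundary G S false v
    Y≗B = proj₂ ∘ boundaries
    side-of : ∀ {E b} → InLinSys G D E → (∀ v → E v ≡ boundary G S b v) → ∃ λ v → S v ≡ b
    side-of E∈|D| E≗ = Product.map₂ (λ Ev → boundary-supp⇒side G S _ (InSupp-resp-≗ G E≗ Ev)) (supported E∈|D|)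

lemma2p2 : (n : ℕ) (G : Graph n) → Connected G →
    (D : Divisor n) → Disconnected G D →
    (𝒜 ℬ : Divisor n → Set) → Splitting G D 𝒜 ℬ →
    Σ (Divisor n) λ D_A → Σ (Divisor n) λ D_B → 𝒜 D_A × ℬ D_B ×
      Σ (Fin n → Bool) λ side → IsCut G side ×
        (∀ u v → 0 < w G u v →
          Between G (InSupp G D_A) (InSupp G D_B) u v ⇔ Between G (InA G side) (InB G side) u v) ×
        _∼_ G (boundary G side true) D × _∼_ G (boundary G side false) D
lemma2p2 n G connected D (_ , _ , (X₀ , X₀∈|D| , X₀≢0) , _) 𝒜 ℬ splitting =
  let X , S , X∈𝒜 , Y∈ℬ = crossing splitting supported (proj₂ ℬ-nonempty) (proj₂ 𝒜-nonempty)
  in  X , fire G S X , X∈𝒜 , Y∈ℬ , S , crossing-cut splitting connected supported X∈𝒜 Y∈ℬ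
  where
  open Splitting splitting
  supported : ∀ {E} → InLinSys G D E → ∃ (InSupp G E)
  supported = members-supported {G = G} X₀∈|D| X₀≢0
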